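{- Let $G$ be an undirected unweighted graph on $n$ vertices with sets $A_0\supseteq\dots\supseteq A_{\log\log n-1}$ obtained by nested vertex sampling, and let $P$ be a shortest path from $s$ to $t$. With high probability, for all $0 \le i \le \log\log n-1$ (for which $a_i,b_i$ exist), every edge on the subpath of $P$ from $s$ to $a_i$ has degree at most $\widetilde{O}(2^{2^i})$, and every edge on the subpath of $P$ from $t$ to $b_i$ has degree at most $\widetilde{O}(2^{2^i})$.
   Context: Nested vertex sampling: $A_0=V(G)$; $A_1$ contains each vertex independently with probability $1/2^{2^1}$; for $2\le i\le\log\log n-1$, $A_i$ contains each vertex of $A_{i-1}$ independently with probability $1/2^{2^{i-1}}$. $pivot_i(x)$ is a vertex of $A_i$ nearest to $x$. $a_i$ is the vertex of $P$ closest to $s$ such that $|a_i\,pivot_i(a_i)|\le 1$; $b_i$ is the vertex of $P$ closest to $t$ such that $|b_i\,pivot_i(b_i)|\le1$. The degree of an edge $(x,y)$ is $\min\{\deg(x),\deg(y)\}$. $\widetilde{O}$ hides $\mathrm{poly}\log n$ factors; "with high probability" means probability at least $1-1/n^c$ for a constant $c>0$. -}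

module Defs where

open import Data.Nat as ℕ using (ℕ; zero; suc; _∸_; _⊓_; _≤ᵇ_)
open import Data.Nat.Logarithm using (⌊log₂_⌋)
open import Data.Integer using (+_)
open import Data.Rational as ℚ using (ℚ; 0ℚ; 1ℚ)
open import Data.Bool using (Bool; true; false; _∧_; _∨_; not; if_then_else_)
open import Data.Fin using (Fin)
open import Data.Fin.Properties using (_≟_)
open import Data.List using (List; []; _∷_; length; reverse; map; concatMap; filter; foldr; allFin)
open import Data.Bool.ListAction using (any; all)
open import Data.List.Membership.Propositional using (_∈_)
open import Data.Vec using (Vec; []; _∷_; toList)
open import Data.Product using (Σ; _×_; _,_)
open import Relation.Binary.PropositionalEquality using (_≡_)
open import Relation.Nullary.Decidable using (⌊_⌋)

record Graph (n : ℕ) : Set where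
  field
    adj       : Fin n → Fin n → Bool
    symmetric : ∀ u v → adj u v ≡ adj v u
    irrefl    : ∀ v → adj v v ≡ false
open Graph public

deg : ∀ {n} → Graph n → Fin n → ℕ
deg G v = length (filter (λ u → adj G v u Data.Bool.≟ true) (allFin _))

edgeDeg : ∀ {n} → Graph n → Fin n → Fin n → ℕ
edgeDeg G x y = deg G x ⊓ deg G y

IsWalk : ∀ {n} → Graph n → List (Fin n) → Set
IsWalk G []           = Data.Unit.⊤ where import Data.Unit
IsWalk G (x ∷ [])     = Data.Unit.⊤ where import Data.Unit
IsWalk G (x ∷ y ∷ xs) = (adj G x y ≡ true) × IsWalk G (y ∷ xs)

WalkFromTo : ∀ {n} → Graph n → Fin n → Fin n → List (Fin n) → Set
WalkFromTo G s t []       = Data.Empty.⊥ where import Data.Empty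
WalkFromTo G s t (x ∷ xs) =
  (x ≡ s) × (Data.List.last (x ∷ xs) ≡ Data.Maybe.just t) × IsWalk G (x ∷ xs)
  where import Data.Maybe

IsShortestPath : ∀ {n} → Graph n → Fin n → Fin n → List (Fin n) → Set
IsShortestPath G s t P =
  WalkFromTo G s t P × (∀ Q → WalkFromTo G s t Q → length P ℕ.≤ length Q)

levels : ℕ → ℕ
levels n = ⌊log₂ ⌊log₂ n ⌋ ⌋

-- Each vertex v carries independent coins c_1,…,c_{L-1};
-- coin c_i (i ≥ 1) is true with probability 1/2^{2^1} if i = 1,
-- and 1/2^{2^{i-1}} if i ≥ 2.  v ∈ A_i iff c_1 = … = c_i = true.
-- (This is exactly the nested sampling: A_i keeps each vertex of A_{i-1}
--  independently with the stated probability.)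
-- Coins are stored in a list, position j (from 0) holding c_{j+1}.
coinExp : ℕ → ℕ        -- j ↦ e with Pr[c_{j+1}] = 1/2^e
coinExp zero    = 2 ℕ.^ 1
coinExp (suc j) = 2 ℕ.^ (suc j)

Coins : ℕ → ℕ → Set
Coins n k = Vec (Vec Bool k) n

inA : List Bool → ℕ → Bool
inA _        zero    = true
inA []       (suc i) = false
inA (b ∷ bs) (suc i) = b ∧ inA bs i

memberA : ∀ {n k} → Coins n k → ℕ → Fin n → Bool
memberA ω i v = inA (toList (Data.Vec.lookup ω v)) i

allBoolVecs : (k : ℕ) → List (Vec Bool k)
allBoolVecs zero    = [] ∷ []
allBoolVecs (suc k) = concatMap (λ bs → (true ∷ bs) ∷ (false ∷ bs) ∷ []) (allBoolVecs k)

allCoins : (n k : ℕ) → List (Coins n k)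
allCoins zero    k = [] ∷ []
allCoins (suc n) k =
  concatMap (λ rest → map (λ c → c ∷ rest) (allBoolVecs k)) (allCoins n k)

half^ : ℕ → ℚ
half^ e = ℚ._/_ (+ 1) (2 ℕ.^ e) ⦃ nz ⦄
  where
    nz : ℕ.NonZero (2 ℕ.^ e)
    nz = Data.Nat.Properties.m^n≢0 2 e
      where import Data.Nat.Properties

coinWeight : ℕ → List Bool → ℚ
coinWeight j []          = 1ℚ
coinWeight j (true ∷ bs)  = half^ (coinExp j) ℚ.* coinWeight (suc j) bs
coinWeight j (false ∷ bs) = (1ℚ ℚ.- half^ (coinExp j)) ℚ.* coinWeight (suc j) bs

weight : ∀ {n k} → Coins n k → ℚ
weight []       = 1ℚ
weight (c ∷ cs) = coinWeight 0 (toList c) ℚ.* weight cs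

Pr : (n k : ℕ) → (Coins n k → Bool) → ℚ
Pr n k E = foldr ℚ._+_ 0ℚ
  (map (λ ω → if E ω then weight ω else 0ℚ) (allCoins n k))

-- |x pivot_i(x)| ≤ 1  ⇔  x ∈ A_i or some neighbour of x lies in A_i
nearA : ∀ {n k} → Graph n → Coins n k → ℕ → Fin n → Bool
nearA G ω i x = memberA ω i x ∨ any (λ u → adj G x u ∧ memberA ω i u) (allFin _)

-- For a path v₀,v₁,…: let a be the first vertex with near = true
-- (closest to v₀). Check that every edge on the subpath v₀ … a has degree ≤ B.
prefixOK : ∀ {n} → Graph n → (Fin n → Bool) → ℕ → List (Fin n) → Bool
prefixOK G near B []           = true
prefixOK G near B (x ∷ [])     = true
prefixOK G near B (x ∷ y ∷ xs) =
  if near x then true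
  else (if near y then (edgeDeg G x y ≤ᵇ B)
        else ((edgeDeg G x y ≤ᵇ B) ∧ prefixOK G near B (y ∷ xs)))

exists : ∀ {n} → (Fin n → Bool) → List (Fin n) → Bool
exists near P = any near P

goodLevel : ∀ {n k} → Graph n → List (Fin n) → Coins n k → ℕ → ℕ → Bool
goodLevel G P ω i B =
  (not (exists (nearA G ω i) P) ∨ prefixOK G (nearA G ω i) B P) ∧
  (not (exists (nearA G ω i) P) ∨ prefixOK G (nearA G ω i) B (reverse P))

goodAll : ∀ {n k} → Graph n → List (Fin n) → (ℕ → ℕ) → (L : ℕ) → Coins n k → Bool
goodAll G P B L ω = all (λ i → goodLevel G P ω i (B i)) (Data.List.upTo L)

_^ℚ_ : ℚ → ℕ → ℚ
q ^ℚ zero  = 1ℚ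
q ^ℚ suc m = q ℚ.* (q ^ℚ m)

{-# OPTIONS --safe #-}
module Submission where

-- A vertex x of degree above K·2^(2^i) is farther than 1 from A_i only if none of its neighbours
-- is sampled into A_i.  Coins of different vertices are independent and Pr[v ∈ A_i] ≥ 2^-(2^i),
-- so this happens with probability at most (1 - 2^-(2^i))^(K·2^(2^i)) ≤ 2^-K.  If an edge of P
-- between s and a_i (or between b_i and t) has degree above the threshold, its endpoint nearer
-- to s (resp. t) is such a far heavy vertex.  A union bound over the L levels and n vertices,
-- with K = 3(1 + ⌊log₂ n⌋) and L, n ≤ 2^(1 + ⌊log₂ n⌋), bounds the failure probability by 1/n.

open import Defs
open import Data.Nat using (ℕ; _*_; _+_; _^_; _∸_; _≤_)
open import Data.Nat.Logarithm using (⌊log₂_⌋)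
open import Data.Integer using (+_)
open import Data.Rational as ℚ using (ℚ; 1ℚ)
open import Data.Bool using (not)
open import Data.Fin using (Fin)
open import Data.List using (List)
open import Data.Product using (Σ; _×_)

open import Algebra.Bundles using (CommutativeRing)
import Data.Bool as Bool
open import Data.Bool using (Bool; true; false; if_then_else_; _∧_; _∨_; T)
open import Data.Bool.ListAction using (any)
open import Data.Bool.Properties using (T-∧; T-∨)
open import Data.Fin using (zero; suc)
import Data.Integer as ℤ
import Data.Integer.Properties as ℤ
open import Data.List using ([]; _∷_; _++_; map; foldr; concatMap; length; filter; tabulate; allFin; reverse; upTo)
open import Data.List.Membership.Propositional using (_∈_; find; lose)
open import Data.List.Membership.Propositional.Properties using (∈-allFin; ∈-filter⁺; ∈-filter⁻; ∈-upTo⁻)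
open import Data.List.Properties using (length-upTo; length-filter; length-tabulate)
import Data.List.Relation.Unary.Any as Any
open import Data.List.Relation.Unary.Any using (Any; here; there)
open import Data.List.Relation.Unary.Any.Properties using (any⁺; any⁻)
open import Data.List.Relation.Unary.All.Properties using (¬All⇒Any¬; all⁻)
open import Data.Nat using (zero; suc; _<_; _≤ᵇ_; z≤n; s≤s; NonZero)
open import Data.Nat.Logarithm using (⌊log₂⌋-mono-≤; ⌊log₂[2^n]⌋≡n)
import Data.Nat.Properties as ℕ
open import Data.Product using (_,_; proj₂; ∃-syntax)
open import Data.Rational using (0ℚ; ½; toℚᵘ)
import Data.Rational.Properties as ℚ
open import Data.Rational.Solver using (module +-*-Solver)
open import Data.Rational.Unnormalised as ℚᵘ using (mkℚᵘ; *≡*)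
import Data.Rational.Unnormalised.Properties as ℚᵘ
open import Data.Sum using (_⊎_; inj₁; inj₂; [_,_]; [_,_]′)
open import Data.Vec using (Vec; []; _∷_; toList; lookup)
import Data.Vec.Functional as Vector
open import Function using (_∘_; id)
open import Function.Bundles using (Equivalence)
open import Relation.Binary.PropositionalEquality using (_≡_; refl; sym; trans; cong; cong₂; subst; module ≡-Reasoning)
open import Relation.Nullary using (¬_; contradiction)
open import Relation.Nullary.Decidable using (T?)

open CommutativeRing ℚ.+-*-commutativeRing using (commutativeSemiring; semiring)
import Algebra.Properties.CommutativeSemiring.Exp commutativeSemiring as Exp
open import Algebra.Properties.Semiring.Mult semiring using (×-assocˡ; ×-comm-*; ×-assoc-*) renaming (_×_ to _·_)
open +-*-Solver using (solve; _:+_; _:*_; _:-_; _:=_; con)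

private
  variable
    A B : Set

-- Sums over lists

∑ : List A → (A → ℚ) → ℚ
∑ xs f = foldr ℚ._+_ 0ℚ (map f xs)

syntax ∑ xs (λ x → e) = ∑[ x ∈ xs ] e

∑-cong : ∀ (xs : List A) {f g : A → ℚ} → (∀ x → f x ≡ g x) → ∑ xs f ≡ ∑ xs g
∑-cong []       f≗g = refl
∑-cong (x ∷ xs) f≗g = cong₂ ℚ._+_ (f≗g x) (∑-cong xs f≗g)

∑-++ : ∀ (xs ys : List A) f → ∑ (xs ++ ys) f ≡ ∑ xs f ℚ.+ ∑ ys f
∑-++ []       ys f = sym (ℚ.+-identityˡ _)
∑-++ (x ∷ xs) ys f = trans (cong (f x ℚ.+_) (∑-++ xs ys f)) (sym (ℚ.+-assoc (f x) _ _))

∑-map : ∀ (h : B → A) (xs : List B) f → ∑ (map h xs) f ≡ ∑[ x ∈ xs ] f (h x)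
∑-map h []       f = refl
∑-map h (x ∷ xs) f = cong (f (h x) ℚ.+_) (∑-map h xs f)

∑-concatMap : ∀ (h : B → List A) (xs : List B) f → ∑ (concatMap h xs) f ≡ ∑[ x ∈ xs ] ∑ (h x) f
∑-concatMap h []       f = refl
∑-concatMap h (x ∷ xs) f = trans (∑-++ (h x) _ f) (cong (∑ (h x) f ℚ.+_) (∑-concatMap h xs f))

∑-+ : ∀ (xs : List A) f g → ∑[ x ∈ xs ] (f x ℚ.+ g x) ≡ ∑ xs f ℚ.+ ∑ xs g
∑-+ []       f g = refl
∑-+ (x ∷ xs) f g = trans (cong (f x ℚ.+ g x ℚ.+_) (∑-+ xs f g))
  (solve 4 (λ a b c d → (a :+ b) :+ (c :+ d) := (a :+ c) :+ (b :+ d)) refl (f x) (g x) (∑ xs f) (∑ xs g))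

∑-*ˡ : ∀ (xs : List A) c f → ∑[ x ∈ xs ] (c ℚ.* f x) ≡ c ℚ.* ∑ xs f
∑-*ˡ []       c f = sym (ℚ.*-zeroʳ c)
∑-*ˡ (x ∷ xs) c f = trans (cong (c ℚ.* f x ℚ.+_) (∑-*ˡ xs c f)) (sym (ℚ.*-distribˡ-+ c (f x) _))

∑-*ʳ : ∀ (xs : List A) c f → ∑[ x ∈ xs ] (f x ℚ.* c) ≡ ∑ xs f ℚ.* c
∑-*ʳ []       c f = sym (ℚ.*-zeroˡ c)
∑-*ʳ (x ∷ xs) c f = trans (cong (f x ℚ.* c ℚ.+_) (∑-*ʳ xs c f)) (sym (ℚ.*-distribʳ-+ c (f x) _))

∑-zero : ∀ (xs : List A) → ∑[ x ∈ xs ] 0ℚ ≡ 0ℚ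
∑-zero []       = refl
∑-zero (x ∷ xs) = trans (ℚ.+-identityˡ _) (∑-zero xs)

∑-comm : ∀ (xs : List A) (ys : List B) (f : A → B → ℚ) →
         ∑[ x ∈ xs ] ∑[ y ∈ ys ] f x y ≡ ∑[ y ∈ ys ] ∑[ x ∈ xs ] f x y
∑-comm []       ys f = sym (∑-zero ys)
∑-comm (x ∷ xs) ys f = trans (cong (∑ ys (f x) ℚ.+_) (∑-comm xs ys f)) (sym (∑-+ ys (f x) _))

∑-mono-≤ : ∀ (xs : List A) {f g : A → ℚ} → (∀ x → x ∈ xs → f x ℚ.≤ g x) → ∑ xs f ℚ.≤ ∑ xs g
∑-mono-≤ []       f≤g = ℚ.≤-refl
∑-mono-≤ (x ∷ xs) f≤g = ℚ.+-mono-≤ (f≤g x (here refl)) (∑-mono-≤ xs (λ y y∈xs → f≤g y (there y∈xs)))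

∑-nonNeg : ∀ (xs : List A) {f : A → ℚ} → (∀ x → 0ℚ ℚ.≤ f x) → 0ℚ ℚ.≤ ∑ xs f
∑-nonNeg []       f≥0 = ℚ.≤-refl
∑-nonNeg (x ∷ xs) f≥0 = ℚ.+-mono-≤ (f≥0 x) (∑-nonNeg xs f≥0)

term≤∑ : ∀ {xs : List A} {f : A → ℚ} {x} → (∀ y → 0ℚ ℚ.≤ f y) → x ∈ xs → f x ℚ.≤ ∑ xs f
term≤∑ {xs = y ∷ xs} {f} f≥0 (here refl) =
  subst (ℚ._≤ f y ℚ.+ ∑ xs f) (ℚ.+-identityʳ (f y)) (ℚ.+-monoʳ-≤ (f y) (∑-nonNeg xs f≥0))
term≤∑ {xs = y ∷ xs} {f} f≥0 (there x∈xs) =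
  subst (ℚ._≤ f y ℚ.+ ∑ xs f) (ℚ.+-identityˡ _) (ℚ.+-mono-≤ (f≥0 y) (term≤∑ f≥0 x∈xs))

∑≤length· : ∀ (xs : List A) {f : A → ℚ} {c} → (∀ x → x ∈ xs → f x ℚ.≤ c) → ∑ xs f ℚ.≤ length xs · c
∑≤length· []       f≤c = ℚ.≤-refl
∑≤length· (x ∷ xs) f≤c = ℚ.+-mono-≤ (f≤c x (here refl)) (∑≤length· xs (λ y y∈xs → f≤c y (there y∈xs)))

-- Order, powers and multiples in ℚ

0≤1 : 0ℚ ℚ.≤ 1ℚ
0≤1 = ℚ.≤ᵇ⇒≤ _

0≤½ : 0ℚ ℚ.≤ ½
0≤½ = ℚ.≤ᵇ⇒≤ _

½≤1 : ½ ℚ.≤ 1ℚ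
½≤1 = ℚ.≤ᵇ⇒≤ _

*-nonNeg : ∀ {p q} → 0ℚ ℚ.≤ p → 0ℚ ℚ.≤ q → 0ℚ ℚ.≤ p ℚ.* q
*-nonNeg {p} {q} 0≤p 0≤q =
  subst (ℚ._≤ p ℚ.* q) (ℚ.*-zeroˡ q) (ℚ.*-monoʳ-≤-nonNeg q {{ℚ.nonNegative 0≤q}} 0≤p)

*-mono-≤-nonNeg : ∀ {p q r s} → 0ℚ ℚ.≤ p → 0ℚ ℚ.≤ r → p ℚ.≤ q → r ℚ.≤ s → p ℚ.* r ℚ.≤ q ℚ.* s
*-mono-≤-nonNeg {p} {s = s} 0≤p 0≤r p≤q r≤s = ℚ.≤-trans
  (ℚ.*-monoˡ-≤-nonNeg p {{ℚ.nonNegative 0≤p}} r≤s)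
  (ℚ.*-monoʳ-≤-nonNeg s {{ℚ.nonNegative (ℚ.≤-trans 0≤r r≤s)}} p≤q)

p≤q⇒0≤q-p : ∀ {p q} → p ℚ.≤ q → 0ℚ ℚ.≤ q ℚ.- p
p≤q⇒0≤q-p {p} {q} p≤q = subst (ℚ._≤ q ℚ.- p) (ℚ.+-inverseʳ p) (ℚ.+-monoˡ-≤ (ℚ.- p) p≤q)

p≤q⇒r-q≤r-p : ∀ {p q} r → p ℚ.≤ q → r ℚ.- q ℚ.≤ r ℚ.- p
p≤q⇒r-q≤r-p r p≤q = ℚ.+-monoʳ-≤ r (ℚ.neg-antimono-≤ p≤q)

0≤p⇒r-p≤r : ∀ {p} r → 0ℚ ℚ.≤ p → r ℚ.- p ℚ.≤ r
0≤p⇒r-p≤r r 0≤p = ℚ.≤-trans (p≤q⇒r-q≤r-p r 0≤p) (ℚ.≤-reflexive (ℚ.+-identityʳ r))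

^ℚ≡^ : ∀ q n → q ^ℚ n ≡ q Exp.^ n
^ℚ≡^ q zero    = refl
^ℚ≡^ q (suc n) = cong (q ℚ.*_) (^ℚ≡^ q n)

^ℚ-homo-* : ∀ q m n → q ^ℚ (m + n) ≡ q ^ℚ m ℚ.* q ^ℚ n
^ℚ-homo-* q m n rewrite ^ℚ≡^ q (m + n) | ^ℚ≡^ q m | ^ℚ≡^ q n = Exp.^-homo-* q m n

^ℚ-assocʳ : ∀ q m n → (q ^ℚ m) ^ℚ n ≡ q ^ℚ (m * n)
^ℚ-assocʳ q m n rewrite ^ℚ≡^ q m | ^ℚ≡^ (q Exp.^ m) n | ^ℚ≡^ q (m * n) = Exp.^-assocʳ q m n

^ℚ-distrib-* : ∀ p q n → (p ℚ.* q) ^ℚ n ≡ p ^ℚ n ℚ.* q ^ℚ n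
^ℚ-distrib-* p q n rewrite ^ℚ≡^ (p ℚ.* q) n | ^ℚ≡^ p n | ^ℚ≡^ q n = Exp.^-distrib-* p q n

1^ℚn≡1 : ∀ n → 1ℚ ^ℚ n ≡ 1ℚ
1^ℚn≡1 zero    = refl
1^ℚn≡1 (suc n) = trans (ℚ.*-identityˡ _) (1^ℚn≡1 n)

^ℚ-nonNeg : ∀ {q} n → 0ℚ ℚ.≤ q → 0ℚ ℚ.≤ q ^ℚ n
^ℚ-nonNeg zero    0≤q = 0≤1
^ℚ-nonNeg (suc n) 0≤q = *-nonNeg 0≤q (^ℚ-nonNeg n 0≤q)

^ℚ-monoˡ-≤ : ∀ {p q} n → 0ℚ ℚ.≤ p → p ℚ.≤ q → p ^ℚ n ℚ.≤ q ^ℚ n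
^ℚ-monoˡ-≤ zero    0≤p p≤q = ℚ.≤-refl
^ℚ-monoˡ-≤ (suc n) 0≤p p≤q = *-mono-≤-nonNeg 0≤p (^ℚ-nonNeg n 0≤p) p≤q (^ℚ-monoˡ-≤ n 0≤p p≤q)

^ℚ≤1 : ∀ {q} n → 0ℚ ℚ.≤ q → q ℚ.≤ 1ℚ → q ^ℚ n ℚ.≤ 1ℚ
^ℚ≤1 n 0≤q q≤1 = ℚ.≤-trans (^ℚ-monoˡ-≤ n 0≤q q≤1) (ℚ.≤-reflexive (1^ℚn≡1 n))

^ℚ-antimonoʳ-≤ : ∀ {q m n} → 0ℚ ℚ.≤ q → q ℚ.≤ 1ℚ → m ≤ n → q ^ℚ n ℚ.≤ q ^ℚ m
^ℚ-antimonoʳ-≤ {q} {m} {n} 0≤q q≤1 m≤n = begin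
  q ^ℚ n                         ≡⟨ cong (q ^ℚ_) (sym (ℕ.m+[n∸m]≡n m≤n)) ⟩
  q ^ℚ (m + (n ∸ m))             ≡⟨ ^ℚ-homo-* q m (n ∸ m) ⟩
  q ^ℚ m ℚ.* q ^ℚ (n ∸ m)        ≤⟨ ℚ.*-monoˡ-≤-nonNeg (q ^ℚ m) {{ℚ.nonNegative (^ℚ-nonNeg m 0≤q)}}
                                      (^ℚ≤1 (n ∸ m) 0≤q q≤1) ⟩
  q ^ℚ m ℚ.* 1ℚ                  ≡⟨ ℚ.*-identityʳ _ ⟩
  q ^ℚ m                         ∎
  where open ℚ.≤-Reasoning

0≤½^n : ∀ n → 0ℚ ℚ.≤ ½ ^ℚ n
0≤½^n n = ^ℚ-nonNeg n 0≤½

½^n≤1 : ∀ n → ½ ^ℚ n ℚ.≤ 1ℚ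
½^n≤1 n = ^ℚ≤1 n 0≤½ ½≤1

·-nonNeg : ∀ m {q} → 0ℚ ℚ.≤ q → 0ℚ ℚ.≤ m · q
·-nonNeg zero    0≤q = ℚ.≤-refl
·-nonNeg (suc m) 0≤q = ℚ.+-mono-≤ 0≤q (·-nonNeg m 0≤q)

·-monoˡ-≤ : ∀ {m n q} → 0ℚ ℚ.≤ q → m ≤ n → m · q ℚ.≤ n · q
·-monoˡ-≤ {n = n} 0≤q z≤n       = ·-nonNeg n 0≤q
·-monoˡ-≤ {q = q} 0≤q (s≤s m≤n) = ℚ.+-monoʳ-≤ q (·-monoˡ-≤ 0≤q m≤n)

·-monoʳ-≤ : ∀ m {p q} → p ℚ.≤ q → m · p ℚ.≤ m · q
·-monoʳ-≤ zero    p≤q = ℚ.≤-refl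
·-monoʳ-≤ (suc m) p≤q = ℚ.+-mono-≤ p≤q (·-monoʳ-≤ m p≤q)

2^t·½^t≡1 : ∀ t → (2 ^ t) · ½ ^ℚ t ≡ 1ℚ
2^t·½^t≡1 zero    = refl
2^t·½^t≡1 (suc t) = begin
  (2 * 2 ^ t) · (½ ℚ.* ½ ^ℚ t)     ≡⟨ sym (×-assocˡ _ 2 (2 ^ t)) ⟩
  2 · ((2 ^ t) · (½ ℚ.* ½ ^ℚ t))   ≡⟨ cong (2 ·_) (sym (×-comm-* (2 ^ t) ½ (½ ^ℚ t))) ⟩
  2 · (½ ℚ.* ((2 ^ t) · ½ ^ℚ t))   ≡⟨ cong (λ r → 2 · (½ ℚ.* r)) (2^t·½^t≡1 t) ⟩
  2 · (½ ℚ.* 1ℚ)                   ≡⟨⟩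
  1ℚ                               ∎
  where open ≡-Reasoning

2^t·[½^t*r]≡r : ∀ t r → (2 ^ t) · (½ ^ℚ t ℚ.* r) ≡ r
2^t·[½^t*r]≡r t r = begin
  (2 ^ t) · (½ ^ℚ t ℚ.* r)   ≡⟨ sym (×-assoc-* (2 ^ t) (½ ^ℚ t) r) ⟩
  ((2 ^ t) · ½ ^ℚ t) ℚ.* r   ≡⟨ cong (ℚ._* r) (2^t·½^t≡1 t) ⟩
  1ℚ ℚ.* r                   ≡⟨ ℚ.*-identityˡ r ⟩
  r                          ∎
  where open ≡-Reasoning

1/[m*n]≡1/m*1/n : ∀ m n .{{_ : NonZero m}} .{{_ : NonZero n}} →
  (+ 1 ℚ./ (m * n)) {{ℕ.m*n≢0 m n}} ≡ (+ 1 ℚ./ m) ℚ.* (+ 1 ℚ./ n)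
1/[m*n]≡1/m*1/n (suc m) (suc n) = ℚ.toℚᵘ-injective (begin
  toℚᵘ (+ 1 ℚ./ (suc m * suc n))
    ≈⟨ ℚ.toℚᵘ-fromℚᵘ (mkℚᵘ (+ 1) (n + m * suc n)) ⟩
  mkℚᵘ (+ 1) m ℚᵘ.* mkℚᵘ (+ 1) n
    ≈⟨ ℚᵘ.*-cong (ℚᵘ.≃-sym (ℚ.toℚᵘ-fromℚᵘ (mkℚᵘ (+ 1) m))) (ℚᵘ.≃-sym (ℚ.toℚᵘ-fromℚᵘ (mkℚᵘ (+ 1) n))) ⟩
  toℚᵘ (+ 1 ℚ./ suc m) ℚᵘ.* toℚᵘ (+ 1 ℚ./ suc n)
    ≈⟨ ℚ.toℚᵘ-homo-* (+ 1 ℚ./ suc m) (+ 1 ℚ./ suc n) ⟨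
  toℚᵘ ((+ 1 ℚ./ suc m) ℚ.* (+ 1 ℚ./ suc n))
    ∎)
  where open ℚᵘ.≃-Reasoning

half^≡½^ : ∀ e → half^ e ≡ ½ ^ℚ e
half^≡½^ zero    = refl
half^≡½^ (suc e) = begin
  half^ (suc e)         ≡⟨ 1/[m*n]≡1/m*1/n 2 (2 ^ e) {{_}} {{ℕ.m^n≢0 2 e}} ⟩
  ½ ℚ.* half^ e         ≡⟨ cong (½ ℚ.*_) (half^≡½^ e) ⟩
  ½ ℚ.* ½ ^ℚ e          ∎
  where open ≡-Reasoning

0≤half^ : ∀ e → 0ℚ ℚ.≤ half^ e
0≤half^ e = subst (0ℚ ℚ.≤_) (sym (half^≡½^ e)) (0≤½^n e)

half^≤1 : ∀ e → half^ e ℚ.≤ 1ℚ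
half^≤1 e = subst (ℚ._≤ 1ℚ) (sym (half^≡½^ e)) (½^n≤1 e)

+[1+m]/1≡1++m/1 : ∀ m → + suc m ℚ./ 1 ≡ 1ℚ ℚ.+ + m ℚ./ 1
+[1+m]/1≡1++m/1 m = ℚ.toℚᵘ-injective (begin
  toℚᵘ (+ suc m ℚ./ 1)                 ≈⟨ ℚ.toℚᵘ-fromℚᵘ (mkℚᵘ (+ suc m) 0) ⟩
  mkℚᵘ (+ suc m) 0                     ≈⟨ *≡* (trans (ℤ.*-identityʳ (+ suc m)) (sym 1+m*1*1≡1+m)) ⟩
  ℚᵘ.1ℚᵘ ℚᵘ.+ mkℚᵘ (+ m) 0             ≈⟨ ℚᵘ.+-congʳ ℚᵘ.1ℚᵘ (ℚᵘ.≃-sym (ℚ.toℚᵘ-fromℚᵘ (mkℚᵘ (+ m) 0))) ⟩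
  toℚᵘ 1ℚ ℚᵘ.+ toℚᵘ (+ m ℚ./ 1)        ≈⟨ ℚ.toℚᵘ-homo-+ 1ℚ (+ m ℚ./ 1) ⟨
  toℚᵘ (1ℚ ℚ.+ + m ℚ./ 1)              ∎)
  where
    open ℚᵘ.≃-Reasoning
    1+m*1*1≡1+m : (+ 1 ℤ.+ + m ℤ.* + 1) ℤ.* + 1 ≡ + suc m
    1+m*1*1≡1+m = trans (ℤ.*-identityʳ _) (cong (ℤ._+_ (+ 1)) (ℤ.*-identityʳ (+ m)))

+m/1≡m·1 : ∀ m → + m ℚ./ 1 ≡ m · 1ℚ
+m/1≡m·1 zero    = refl
+m/1≡m·1 (suc m) = trans (+[1+m]/1≡1++m/1 m) (cong (1ℚ ℚ.+_) (+m/1≡m·1 m))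

1+m·x≤[1+x]^m : ∀ {x} m → 0ℚ ℚ.≤ x → 1ℚ ℚ.+ m · x ℚ.≤ (1ℚ ℚ.+ x) ^ℚ m
1+m·x≤[1+x]^m     zero    0≤x = ℚ.≤-refl
1+m·x≤[1+x]^m {x} (suc m) 0≤x = begin
  1ℚ ℚ.+ (x ℚ.+ m · x)                       ≤⟨ p≤p+q (*-nonNeg 0≤x (·-nonNeg m 0≤x)) ⟩
  1ℚ ℚ.+ (x ℚ.+ m · x) ℚ.+ x ℚ.* (m · x)     ≡⟨ solve 2 (λ x y → con 1ℚ :+ (x :+ y) :+ x :* y
                                                            := (con 1ℚ :+ x) :* (con 1ℚ :+ y)) refl x (m · x) ⟩
  (1ℚ ℚ.+ x) ℚ.* (1ℚ ℚ.+ m · x)              ≤⟨ ℚ.*-monoˡ-≤-nonNeg (1ℚ ℚ.+ x) {{ℚ.nonNegative 0≤1+x}}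
                                                  (1+m·x≤[1+x]^m m 0≤x) ⟩
  (1ℚ ℚ.+ x) ℚ.* (1ℚ ℚ.+ x) ^ℚ m             ∎
  where
    open ℚ.≤-Reasoning
    0≤1+x : 0ℚ ℚ.≤ 1ℚ ℚ.+ x
    0≤1+x = ℚ.+-mono-≤ 0≤1 0≤x
    p≤p+q : ∀ {p q} → 0ℚ ℚ.≤ q → p ℚ.≤ p ℚ.+ q
    p≤p+q {p} 0≤q = ℚ.≤-trans (ℚ.≤-reflexive (sym (ℚ.+-identityʳ p))) (ℚ.+-monoʳ-≤ p 0≤q)

[1-½^a]^2^a≤½ : ∀ a → (1ℚ ℚ.- ½ ^ℚ a) ^ℚ (2 ^ a) ℚ.≤ ½
[1-½^a]^2^a≤½ a = begin
  r ^ℚ N                                ≡⟨ solve 1 (λ y → y := (y :* (con 1ℚ :+ con 1ℚ)) :* con ½) refl (r ^ℚ N) ⟩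
  (r ^ℚ N ℚ.* (1ℚ ℚ.+ 1ℚ)) ℚ.* ½        ≡⟨ cong (λ s → (r ^ℚ N ℚ.* (1ℚ ℚ.+ s)) ℚ.* ½) (sym (2^t·½^t≡1 a)) ⟩
  (r ^ℚ N ℚ.* (1ℚ ℚ.+ N · h)) ℚ.* ½     ≤⟨ ℚ.*-monoʳ-≤-nonNeg ½ {{ℚ.nonNegative 0≤½}}
                                             (ℚ.*-monoˡ-≤-nonNeg (r ^ℚ N) {{ℚ.nonNegative (^ℚ-nonNeg N 0≤r)}}
                                               (1+m·x≤[1+x]^m N (0≤½^n a))) ⟩
  (r ^ℚ N ℚ.* (1ℚ ℚ.+ h) ^ℚ N) ℚ.* ½    ≡⟨ cong (ℚ._* ½) (sym (^ℚ-distrib-* r (1ℚ ℚ.+ h) N)) ⟩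
  (r ℚ.* (1ℚ ℚ.+ h)) ^ℚ N ℚ.* ½         ≤⟨ ℚ.*-monoʳ-≤-nonNeg ½ {{ℚ.nonNegative 0≤½}} (^ℚ≤1 N 0≤r[1+h] r[1+h]≤1) ⟩
  1ℚ ℚ.* ½                              ≡⟨ ℚ.*-identityˡ ½ ⟩
  ½                                     ∎
  where
    open ℚ.≤-Reasoning
    h r : ℚ
    h = ½ ^ℚ a
    r = 1ℚ ℚ.- h
    N : ℕ
    N = 2 ^ a
    0≤r : 0ℚ ℚ.≤ r
    0≤r = p≤q⇒0≤q-p (½^n≤1 a)
    r[1+h]≡1-h*h : r ℚ.* (1ℚ ℚ.+ h) ≡ 1ℚ ℚ.- h ℚ.* h
    r[1+h]≡1-h*h = solve 1 (λ h → (con 1ℚ :- h) :* (con 1ℚ :+ h) := con 1ℚ :- h :* h) refl h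
    0≤r[1+h] : 0ℚ ℚ.≤ r ℚ.* (1ℚ ℚ.+ h)
    0≤r[1+h] = *-nonNeg 0≤r (ℚ.+-mono-≤ 0≤1 (0≤½^n a))
    r[1+h]≤1 : r ℚ.* (1ℚ ℚ.+ h) ℚ.≤ 1ℚ
    r[1+h]≤1 = ℚ.≤-trans (ℚ.≤-reflexive r[1+h]≡1-h*h) (0≤p⇒r-p≤r 1ℚ (*-nonNeg (0≤½^n a) (0≤½^n a)))

-- The sampling space

coinWeight-nonNeg : ∀ j bs → 0ℚ ℚ.≤ coinWeight j bs
coinWeight-nonNeg j []           = 0≤1
coinWeight-nonNeg j (true ∷ bs)  = *-nonNeg (0≤half^ (coinExp j)) (coinWeight-nonNeg (suc j) bs)
coinWeight-nonNeg j (false ∷ bs) = *-nonNeg (p≤q⇒0≤q-p (half^≤1 (coinExp j))) (coinWeight-nonNeg (suc j) bs)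

weight-nonNeg : ∀ {n k} (ω : Coins n k) → 0ℚ ℚ.≤ weight ω
weight-nonNeg []      = 0≤1
weight-nonNeg (c ∷ ω) = *-nonNeg (coinWeight-nonNeg 0 (toList c)) (weight-nonNeg ω)

weightOn : ∀ {n k} → (Coins n k → Bool) → Coins n k → ℚ
weightOn E ω = if E ω then weight ω else 0ℚ

weightOn-nonNeg : ∀ {n k} (E : Coins n k → Bool) ω → 0ℚ ℚ.≤ weightOn E ω
weightOn-nonNeg E ω with E ω
... | true  = weight-nonNeg ω
... | false = ℚ.≤-refl

weightOn-T : ∀ {n k} (E : Coins n k → Bool) {ω} → T (E ω) → weightOn E ω ≡ weight ω
weightOn-T E {ω} Eω with E ω
... | true = refl

Pr-union-bound : ∀ {I : Set} {n k} (Is : List I) (E : Coins n k → Bool) (F : I → Coins n k → Bool) →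
  (∀ ω → T (E ω) → Any (λ i → T (F i ω)) Is) → Pr n k E ℚ.≤ ∑[ i ∈ Is ] Pr n k (F i)
Pr-union-bound {n = n} {k} Is E F E⇒F = begin
  Pr n k E                                             ≤⟨ ∑-mono-≤ (allCoins n k) (λ ω _ → pointwise ω) ⟩
  ∑[ ω ∈ allCoins n k ] ∑[ i ∈ Is ] weightOn (F i) ω   ≡⟨ ∑-comm (allCoins n k) Is (λ ω i → weightOn (F i) ω) ⟩
  ∑[ i ∈ Is ] Pr n k (F i)                             ∎
  where
    open ℚ.≤-Reasoning
    pointwise : ∀ ω → weightOn E ω ℚ.≤ ∑[ i ∈ Is ] weightOn (F i) ω
    pointwise ω with E ω in Eω
    ... | false = ∑-nonNeg Is (λ i → weightOn-nonNeg (F i) ω)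
    ... | true  with i , i∈Is , Fiω ← find (E⇒F ω (subst T (sym Eω) _)) =
      ℚ.≤-trans (ℚ.≤-reflexive (sym (weightOn-T (F i) Fiω)))
                (term≤∑ (λ i → weightOn-nonNeg (F i) ω) i∈Is)

∑-allCoins-suc : ∀ n k (f : Coins (suc n) k → ℚ) →
  ∑ (allCoins (suc n) k) f ≡ ∑[ ω ∈ allCoins n k ] ∑[ c ∈ allBoolVecs k ] f (c ∷ ω)
∑-allCoins-suc n k f = trans (∑-concatMap _ (allCoins n k) f)
  (∑-cong (allCoins n k) (λ ω → ∑-map (_∷ ω) (allBoolVecs k) f))

∏ : ∀ {n} → (Fin n → ℚ) → ℚ
∏ = Vector.foldr ℚ._*_ 1ℚ

∏-cong : ∀ {n} {f g : Fin n → ℚ} → (∀ v → f v ≡ g v) → ∏ f ≡ ∏ g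
∏-cong {zero}  f≗g = refl
∏-cong {suc n} f≗g = cong₂ ℚ._*_ (f≗g zero) (∏-cong (f≗g ∘ suc))

everyVertex : ∀ {n k} → (Fin n → Vec Bool k → Bool) → Coins n k → Bool
everyVertex g []      = true
everyVertex g (c ∷ ω) = g zero c ∧ everyVertex (g ∘ suc) ω

everyVertex-intro : ∀ {n k} (g : Fin n → Vec Bool k → Bool) ω →
  (∀ v → T (g v (lookup ω v))) → T (everyVertex g ω)
everyVertex-intro g []      _ = _
everyVertex-intro g (c ∷ ω) h = Equivalence.from T-∧ (h zero , everyVertex-intro (g ∘ suc) ω (h ∘ suc))

coinPr : ℕ → (k : ℕ) → (Vec Bool k → Bool) → ℚ
coinPr j k h = ∑[ c ∈ allBoolVecs k ] (if h c then coinWeight j (toList c) else 0ℚ)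

if-∧-* : ∀ a b (x y : ℚ) →
  (if a ∧ b then x ℚ.* y else 0ℚ) ≡ (if a then x else 0ℚ) ℚ.* (if b then y else 0ℚ)
if-∧-* true  true  x y = refl
if-∧-* true  false x y = sym (ℚ.*-zeroʳ x)
if-∧-* false b     x y = sym (ℚ.*-zeroˡ (if b then y else 0ℚ))

Pr-everyVertex : ∀ n k (g : Fin n → Vec Bool k → Bool) →
  Pr n k (everyVertex g) ≡ ∏ (λ v → coinPr 0 k (g v))
Pr-everyVertex zero    k g = refl
Pr-everyVertex (suc n) k g = begin
  Pr (suc n) k (everyVertex g)
    ≡⟨ ∑-allCoins-suc n k (weightOn (everyVertex g)) ⟩
  ∑[ ω ∈ allCoins n k ] ∑[ c ∈ allBoolVecs k ] weightOn (everyVertex g) (c ∷ ω)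
    ≡⟨ ∑-cong (allCoins n k) (λ ω → ∑-cong (allBoolVecs k) (λ c →
         if-∧-* (g zero c) (everyVertex g′ ω) (coinWeight 0 (toList c)) (weight ω))) ⟩
  ∑[ ω ∈ allCoins n k ] ∑[ c ∈ allBoolVecs k ]
    ((if g zero c then coinWeight 0 (toList c) else 0ℚ) ℚ.* weightOn (everyVertex g′) ω)
    ≡⟨ ∑-cong (allCoins n k) (λ ω → ∑-*ʳ (allBoolVecs k) (weightOn (everyVertex g′) ω) _) ⟩
  ∑[ ω ∈ allCoins n k ] (coinPr 0 k (g zero) ℚ.* weightOn (everyVertex g′) ω)
    ≡⟨ ∑-*ˡ (allCoins n k) (coinPr 0 k (g zero)) (weightOn (everyVertex g′)) ⟩
  coinPr 0 k (g zero) ℚ.* Pr n k (everyVertex g′)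
    ≡⟨ cong (coinPr 0 k (g zero) ℚ.*_) (Pr-everyVertex n k g′) ⟩
  coinPr 0 k (g zero) ℚ.* ∏ (λ v → coinPr 0 k (g′ v))
    ∎
  where
    open ≡-Reasoning
    g′ : Fin n → Vec Bool k → Bool
    g′ = g ∘ suc

coinPr-true : ∀ j k → coinPr j k (λ _ → true) ≡ 1ℚ
coinPr-true j zero    = refl
coinPr-true j (suc k) = begin
  coinPr j (suc k) (λ _ → true)
    ≡⟨ ∑-concatMap _ (allBoolVecs k) _ ⟩
  ∑[ bs ∈ allBoolVecs k ] (q ℚ.* w bs ℚ.+ ((1ℚ ℚ.- q) ℚ.* w bs ℚ.+ 0ℚ))
    ≡⟨ ∑-cong (allBoolVecs k) (λ bs →
         solve 2 (λ q x → q :* x :+ ((con 1ℚ :- q) :* x :+ con 0ℚ) := x) refl q (w bs)) ⟩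
  coinPr (suc j) k (λ _ → true)
    ≡⟨ coinPr-true (suc j) k ⟩
  1ℚ ∎
  where
    open ≡-Reasoning
    q : ℚ
    q = half^ (coinExp j)
    w : Vec Bool k → ℚ
    w bs = coinWeight (suc j) (toList bs)

coinPr-not : ∀ j k h → coinPr j k (not ∘ h) ≡ 1ℚ ℚ.- coinPr j k h
coinPr-not j k h = begin
  b                   ≡⟨ solve 2 (λ a b → b := (a :+ b) :- a) refl a b ⟩
  (a ℚ.+ b) ℚ.- a     ≡⟨ cong (ℚ._- a) a+b≡1 ⟩
  1ℚ ℚ.- a            ∎
  where
    open ≡-Reasoning
    a b : ℚ
    a = coinPr j k h
    b = coinPr j k (not ∘ h)
    split : ∀ c → (if h c then coinWeight j (toList c) else 0ℚ)
                  ℚ.+ (if not (h c) then coinWeight j (toList c) else 0ℚ) ≡ coinWeight j (toList c)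
    split c with h c
    ... | true  = ℚ.+-identityʳ _
    ... | false = ℚ.+-identityˡ _
    a+b≡1 : a ℚ.+ b ≡ 1ℚ
    a+b≡1 = trans (sym (∑-+ (allBoolVecs k) _ _)) (trans (∑-cong (allBoolVecs k) split) (coinPr-true j k))

inAProb : ℕ → ℕ → ℚ
inAProb j zero    = 1ℚ
inAProb j (suc i) = half^ (coinExp j) ℚ.* inAProb (suc j) i

coinPr-inA : ∀ j k i → i ≤ k → coinPr j k (λ c → inA (toList c) i) ≡ inAProb j i
coinPr-inA j k       zero    _         = coinPr-true j k
coinPr-inA j (suc k) (suc i) (s≤s i≤k) = begin
  coinPr j (suc k) (λ c → inA (toList c) (suc i))
    ≡⟨ ∑-concatMap _ (allBoolVecs k) _ ⟩
  ∑[ bs ∈ allBoolVecs k ] ((if inA (toList bs) i then q ℚ.* w bs else 0ℚ) ℚ.+ (0ℚ ℚ.+ 0ℚ))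
    ≡⟨ ∑-cong (allBoolVecs k) (λ bs → firstCoinHeads (inA (toList bs) i) (w bs)) ⟩
  ∑[ bs ∈ allBoolVecs k ] (q ℚ.* (if inA (toList bs) i then w bs else 0ℚ))
    ≡⟨ ∑-*ˡ (allBoolVecs k) q _ ⟩
  q ℚ.* coinPr (suc j) k (λ c → inA (toList c) i)
    ≡⟨ cong (q ℚ.*_) (coinPr-inA (suc j) k i i≤k) ⟩
  q ℚ.* inAProb (suc j) i ∎
  where
    open ≡-Reasoning
    q : ℚ
    q = half^ (coinExp j)
    w : Vec Bool k → ℚ
    w bs = coinWeight (suc j) (toList bs)
    firstCoinHeads : ∀ a x → (if a then q ℚ.* x else 0ℚ) ℚ.+ (0ℚ ℚ.+ 0ℚ) ≡ q ℚ.* (if a then x else 0ℚ)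
    firstCoinHeads true  x = ℚ.+-identityʳ _
    firstCoinHeads false x = sym (ℚ.*-zeroʳ q)

2^[1+m]≡2^m+2^m : ∀ m → 2 ^ suc m ≡ 2 ^ m + 2 ^ m
2^[1+m]≡2^m+2^m m = cong (_+_ (2 ^ m)) (ℕ.+-identityʳ (2 ^ m))

-- The exponents 2^(j+1) + 2^(j+1) + 2^(j+2) + ⋯ + 2^(j+i) telescope to 2^(j+1+i).
inAProb-telescope : ∀ j i → inAProb (suc j) i ℚ.* ½ ^ℚ (2 ^ suc j) ≡ ½ ^ℚ (2 ^ (suc j + i))
inAProb-telescope j zero    = trans (ℚ.*-identityˡ _) (cong (λ m → ½ ^ℚ (2 ^ m)) (sym (ℕ.+-identityʳ (suc j))))
inAProb-telescope j (suc i) = begin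
  (half^ (2 ^ suc j) ℚ.* p) ℚ.* h    ≡⟨ cong (λ z → (z ℚ.* p) ℚ.* h) (half^≡½^ (2 ^ suc j)) ⟩
  (h ℚ.* p) ℚ.* h                    ≡⟨ solve 2 (λ h p → (h :* p) :* h := p :* (h :* h)) refl h p ⟩
  p ℚ.* (h ℚ.* h)                    ≡⟨ cong (p ℚ.*_) (sym (^ℚ-homo-* ½ (2 ^ suc j) (2 ^ suc j))) ⟩
  p ℚ.* ½ ^ℚ (2 ^ suc j + 2 ^ suc j) ≡⟨ cong (λ m → p ℚ.* ½ ^ℚ m) (sym (2^[1+m]≡2^m+2^m (suc j))) ⟩
  p ℚ.* ½ ^ℚ (2 ^ suc (suc j))       ≡⟨ inAProb-telescope (suc j) i ⟩
  ½ ^ℚ (2 ^ (suc (suc j) + i))       ≡⟨ cong (λ m → ½ ^ℚ (2 ^ m)) (sym (ℕ.+-suc (suc j) i)) ⟩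
  ½ ^ℚ (2 ^ (suc j + suc i))         ∎
  where
    open ≡-Reasoning
    p h : ℚ
    p = inAProb (suc (suc j)) i
    h = ½ ^ℚ (2 ^ suc j)

inAProb0[1+i]≡½^2^[1+i] : ∀ i → inAProb 0 (suc i) ≡ ½ ^ℚ (2 ^ suc i)
inAProb0[1+i]≡½^2^[1+i] i = begin
  half^ 2 ℚ.* inAProb 1 i    ≡⟨ cong (ℚ._* inAProb 1 i) (half^≡½^ 2) ⟩
  ½ ^ℚ 2 ℚ.* inAProb 1 i     ≡⟨ ℚ.*-comm _ (inAProb 1 i) ⟩
  inAProb 1 i ℚ.* ½ ^ℚ 2     ≡⟨ inAProb-telescope 0 i ⟩
  ½ ^ℚ (2 ^ suc i)           ∎
  where open ≡-Reasoning

½^2^i≤inAProb : ∀ i → ½ ^ℚ (2 ^ i) ℚ.≤ inAProb 0 i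
½^2^i≤inAProb zero    = ½≤1
½^2^i≤inAProb (suc i) = ℚ.≤-reflexive (sym (inAProb0[1+i]≡½^2^[1+i] i))

inAProb≤1 : ∀ i → inAProb 0 i ℚ.≤ 1ℚ
inAProb≤1 zero    = ℚ.≤-refl
inAProb≤1 (suc i) = ℚ.≤-trans (ℚ.≤-reflexive (inAProb0[1+i]≡½^2^[1+i] i)) (½^n≤1 (2 ^ suc i))

noNeighbourIn : ∀ {n k} → Graph n → ℕ → Fin n → Coins n k → Bool
noNeighbourIn G i x = everyVertex (λ v c → not (adj G x v ∧ inA (toList c) i))

∏-if≡^count : ∀ {m n} (P : Fin m → Bool) (f : Fin n → Fin m) q →
  ∏ (λ v → if P (f v) then q else 1ℚ) ≡ q ^ℚ length (filter (λ u → P u Bool.≟ true) (tabulate f))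
∏-if≡^count {n = zero}  P f q = refl
∏-if≡^count {n = suc n} P f q with P (f zero)
... | true  = cong (q ℚ.*_) (∏-if≡^count P (f ∘ suc) q)
... | false = trans (ℚ.*-identityˡ _) (∏-if≡^count P (f ∘ suc) q)

Pr-noNeighbourIn : ∀ {n k} (G : Graph n) {i} x → i ≤ k →
  Pr n k (noNeighbourIn G i x) ≡ (1ℚ ℚ.- inAProb 0 i) ^ℚ deg G x
Pr-noNeighbourIn {n} {k} G {i} x i≤k = begin
  Pr n k (noNeighbourIn G i x)
    ≡⟨ Pr-everyVertex n k _ ⟩
  ∏ (λ v → coinPr 0 k (λ c → not (adj G x v ∧ inA (toList c) i)))
    ≡⟨ ∏-cong (λ v → vertexAvoids (adj G x v)) ⟩
  ∏ (λ v → if adj G x v then 1ℚ ℚ.- inAProb 0 i else 1ℚ)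
    ≡⟨ ∏-if≡^count (adj G x) id _ ⟩
  (1ℚ ℚ.- inAProb 0 i) ^ℚ deg G x ∎
  where
    open ≡-Reasoning
    vertexAvoids : ∀ b → coinPr 0 k (λ c → not (b ∧ inA (toList c) i))
                         ≡ (if b then 1ℚ ℚ.- inAProb 0 i else 1ℚ)
    vertexAvoids true  = trans (coinPr-not 0 k _) (cong (ℚ._-_ 1ℚ) (coinPr-inA 0 k i i≤k))
    vertexAvoids false = coinPr-true 0 k

Pr-noNeighbourIn≤ : ∀ {n k} (G : Graph n) {i x} K → i ≤ k → K * 2 ^ (2 ^ i) ≤ deg G x →
  Pr n k (noNeighbourIn G i x) ℚ.≤ ½ ^ℚ K
Pr-noNeighbourIn≤ {n} {k} G {i} {x} K i≤k heavy = begin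
  Pr n k (noNeighbourIn G i x)        ≡⟨ Pr-noNeighbourIn G x i≤k ⟩
  (1ℚ ℚ.- inAProb 0 i) ^ℚ deg G x    ≤⟨ ^ℚ-monoˡ-≤ (deg G x) (p≤q⇒0≤q-p (inAProb≤1 i))
                                          (p≤q⇒r-q≤r-p 1ℚ (½^2^i≤inAProb i)) ⟩
  r ^ℚ deg G x                        ≤⟨ ^ℚ-antimonoʳ-≤ 0≤r r≤1 (subst (_≤ deg G x) (ℕ.*-comm K N) heavy) ⟩
  r ^ℚ (N * K)                        ≡⟨ sym (^ℚ-assocʳ r N K) ⟩
  (r ^ℚ N) ^ℚ K                       ≤⟨ ^ℚ-monoˡ-≤ K (^ℚ-nonNeg N 0≤r) ([1-½^a]^2^a≤½ (2 ^ i)) ⟩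
  ½ ^ℚ K                              ∎
  where
    open ℚ.≤-Reasoning
    N : ℕ
    N = 2 ^ (2 ^ i)
    r : ℚ
    r = 1ℚ ℚ.- ½ ^ℚ (2 ^ i)
    0≤r : 0ℚ ℚ.≤ r
    0≤r = p≤q⇒0≤q-p (½^n≤1 (2 ^ i))
    r≤1 : r ℚ.≤ 1ℚ
    r≤1 = 0≤p⇒r-p≤r 1ℚ (0≤½^n (2 ^ i))

-- Far heavy vertices on the path

¬T⇒T-not : ∀ {b} → ¬ T b → T (not b)
¬T⇒T-not {false} _  = _
¬T⇒T-not {true}  b̸ = b̸ _

T-not⇒¬T : ∀ {b} → T (not b) → ¬ T b
T-not⇒¬T {false} _ = id

¬T-∨∧∨ : ∀ a b c → ¬ T ((a ∨ b) ∧ (a ∨ c)) → ¬ T b ⊎ ¬ T c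
¬T-∨∧∨ true  b     c t̸ = contradiction _ t̸
¬T-∨∧∨ false false c _ = inj₁ id
¬T-∨∧∨ false true  c c̸ = inj₂ c̸

edgeDeg≰⇒<deg : ∀ {n} (G : Graph n) {B} x y → ¬ T (edgeDeg G x y ≤ᵇ B) → B < deg G x
edgeDeg≰⇒<deg G x y d≰B = ℕ.<-≤-trans (ℕ.≰⇒> (d≰B ∘ ℕ.≤⇒≤ᵇ)) (ℕ.m⊓n≤m (deg G x) (deg G y))

prefixOK-∷⁻ : ∀ {n} (G : Graph n) near B x y xs → ¬ T (prefixOK G near B (x ∷ y ∷ xs)) →
  ¬ T (near x) × (¬ T (edgeDeg G x y ≤ᵇ B) ⊎ ¬ T (prefixOK G near B (y ∷ xs)))
prefixOK-∷⁻ G near B x y xs ok̸ with near x | near y | edgeDeg G x y ≤ᵇ B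
... | true  | _     | _     = contradiction _ ok̸
... | false | _     | false = id , inj₁ id
... | false | true  | true  = contradiction _ ok̸
... | false | false | true  = id , inj₂ ok̸

¬prefixOK⇒farHeavyVertex : ∀ {n} (G : Graph n) near B (Q : List (Fin n)) → ¬ T (prefixOK G near B Q) →
  ∃[ x ] (¬ T (near x) × B < deg G x)
¬prefixOK⇒farHeavyVertex G near B []           ok̸ = contradiction _ ok̸
¬prefixOK⇒farHeavyVertex G near B (x ∷ [])     ok̸ = contradiction _ ok̸
¬prefixOK⇒farHeavyVertex G near B (x ∷ y ∷ xs) ok̸ =
  let x-far , edge-or-rest = prefixOK-∷⁻ G near B x y xs ok̸ in
  [ (λ xy-heavy → x , x-far , edgeDeg≰⇒<deg G x y xy-heavy)
  , ¬prefixOK⇒farHeavyVertex G near B (y ∷ xs)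
  ] edge-or-rest

far⇒noNeighbourIn : ∀ {n k} (G : Graph n) (ω : Coins n k) i x →
  ¬ T (nearA G ω i x) → T (noNeighbourIn G i x ω)
far⇒noNeighbourIn G ω i x x-far = everyVertex-intro _ ω λ v → ¬T⇒T-not λ v∈N[x]∩A →
  x-far (Equivalence.from T-∨ (inj₂ (any⁺ _ (lose (∈-allFin v) v∈N[x]∩A))))

heavyVertices : ∀ {n} → Graph n → ℕ → List (Fin n)
heavyVertices {n} G B = filter (λ x → B ℕ.<? deg G x) (allFin n)

length-heavyVertices : ∀ {n} (G : Graph n) B → length (heavyVertices G B) ≤ n
length-heavyVertices {n} G B =
  ℕ.≤-trans (length-filter (λ x → B ℕ.<? deg G x) (allFin n)) (ℕ.≤-reflexive (length-tabulate {n = n} id))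

someHeavyVertexAvoids : ∀ {n k} → Graph n → ℕ → ℕ → Coins n k → Bool
someHeavyVertexAvoids G B i ω = any (λ x → noNeighbourIn G i x ω) (heavyVertices G B)

badLevel⇒someHeavyVertexAvoids : ∀ {n k} (G : Graph n) P (ω : Coins n k) i B →
  ¬ T (goodLevel G P ω i B) → T (someHeavyVertexAvoids G B i ω)
badLevel⇒someHeavyVertexAvoids {n} G P ω i B bad =
  let x , x-far , heavy = [ ¬prefixOK⇒farHeavyVertex G near B P
                            , ¬prefixOK⇒farHeavyVertex G near B (reverse P)
                            ]′ (¬T-∨∧∨ (not (exists near P)) _ _ bad)
  in any⁺ _ (lose (∈-filter⁺ (λ x → B ℕ.<? deg G x) (∈-allFin x) heavy)
                  (far⇒noNeighbourIn G ω i x x-far))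
  where
    near : Fin n → Bool
    near = nearA G ω i

notGoodAll⇒someLevelFails : ∀ {n k} (G : Graph n) P (ω : Coins n k) B L → T (not (goodAll G P B L ω)) →
  Any (λ i → T (someHeavyVertexAvoids G (B i) i ω)) (upTo L)
notGoodAll⇒someLevelFails G P ω B L bad =
  Any.map (λ {i} → badLevel⇒someHeavyVertexAvoids G P ω i (B i))
          (¬All⇒Any¬ (T? ∘ good) (upTo L) (T-not⇒¬T bad ∘ all⁻ good))
  where
    good : ℕ → Bool
    good i = goodLevel G P ω i (B i)

Pr-someHeavyVertexAvoids≤ : ∀ {n k} (G : Graph n) {i} K → i ≤ k →
  Pr n k (someHeavyVertexAvoids G (K * 2 ^ (2 ^ i)) i) ℚ.≤ n · ½ ^ℚ K
Pr-someHeavyVertexAvoids≤ {n} {k} G {i} K i≤k = begin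
  Pr n k (someHeavyVertexAvoids G θ i)
    ≤⟨ Pr-union-bound (heavyVertices G θ) _ (noNeighbourIn G i) (λ _ → any⁻ _ (heavyVertices G θ)) ⟩
  ∑[ x ∈ heavyVertices G θ ] Pr n k (noNeighbourIn G i x)
    ≤⟨ ∑≤length· (heavyVertices G θ) (λ x x∈ → Pr-noNeighbourIn≤ G K i≤k (ℕ.<⇒≤ (heavy x∈))) ⟩
  length (heavyVertices G θ) · ½ ^ℚ K
    ≤⟨ ·-monoˡ-≤ (0≤½^n K) (length-heavyVertices G θ) ⟩
  n · ½ ^ℚ K ∎
  where
    open ℚ.≤-Reasoning
    θ : ℕ
    θ = K * 2 ^ (2 ^ i)
    heavy : ∀ {x} → x ∈ heavyVertices G θ → θ < deg G x
    heavy = proj₂ ∘ ∈-filter⁻ (λ x → θ ℕ.<? deg G x) {xs = allFin n}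

m<n⇒m≤n∸1 : ∀ {m n} → m < n → m ≤ n ∸ 1
m<n⇒m≤n∸1 {n = suc n} (s≤s m≤n) = m≤n

Pr-notGoodAll≤ : ∀ {n} (G : Graph n) (P : List (Fin n)) K L →
  Pr n (L ∸ 1) (λ ω → not (goodAll G P (λ i → K * 2 ^ (2 ^ i)) L ω)) ℚ.≤ L · (n · ½ ^ℚ K)
Pr-notGoodAll≤ {n} G P K L = begin
  Pr n (L ∸ 1) _
    ≤⟨ Pr-union-bound (upTo L) _ (λ i → someHeavyVertexAvoids G (K * 2 ^ (2 ^ i)) i)
                      (λ ω → notGoodAll⇒someLevelFails G P ω _ L) ⟩
  ∑[ i ∈ upTo L ] Pr n (L ∸ 1) (someHeavyVertexAvoids G (K * 2 ^ (2 ^ i)) i)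
    ≤⟨ ∑≤length· (upTo L) (λ i i∈upTo → Pr-someHeavyVertexAvoids≤ G K (m<n⇒m≤n∸1 (∈-upTo⁻ i∈upTo))) ⟩
  length (upTo L) · (n · ½ ^ℚ K)
    ≡⟨ cong (_· (n · ½ ^ℚ K)) (length-upTo L) ⟩
  L · (n · ½ ^ℚ K) ∎
  where open ℚ.≤-Reasoning

-- The bound 1/n

n<2^n : ∀ n → n < 2 ^ n
n<2^n zero    = s≤s z≤n
n<2^n (suc n) = ℕ.+-mono-≤-< (ℕ.m^n>0 2 n) (ℕ.<-≤-trans (n<2^n n) (ℕ.m≤m+n (2 ^ n) 0))

⌊log₂n⌋≤n : ∀ n → ⌊log₂ n ⌋ ≤ n
⌊log₂n⌋≤n n = subst (⌊log₂ n ⌋ ≤_) (⌊log₂[2^n]⌋≡n n) (⌊log₂⌋-mono-≤ (ℕ.<⇒≤ (n<2^n n)))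

n<2^[1+⌊log₂n⌋] : ∀ n → n < 2 ^ (1 + ⌊log₂ n ⌋)
n<2^[1+⌊log₂n⌋] n = ℕ.≰⇒> λ 2^[1+⌊log₂n⌋]≤n →
  ℕ.1+n≰n (subst (_≤ ⌊log₂ n ⌋) (⌊log₂[2^n]⌋≡n (1 + ⌊log₂ n ⌋)) (⌊log₂⌋-mono-≤ 2^[1+⌊log₂n⌋]≤n))

levels≤n : ∀ n → levels n ≤ n
levels≤n n = ℕ.≤-trans (⌊log₂n⌋≤n ⌊log₂ n ⌋) (⌊log₂n⌋≤n n)

L·[n·½^3t]·n≤1 : ∀ t {L n X} → L ≤ 2 ^ t → n ≤ 2 ^ t →
  X ℚ.≤ L · (n · ½ ^ℚ (3 * t)) → X ℚ.* (+ n ℚ./ 1) ℚ.≤ 1ℚ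
L·[n·½^3t]·n≤1 t {L} {n} {X} L≤M n≤M X≤ = begin
  X ℚ.* (+ n ℚ./ 1)             ≡⟨ cong (X ℚ.*_) (+m/1≡m·1 n) ⟩
  X ℚ.* (n · 1ℚ)                ≤⟨ ℚ.*-monoʳ-≤-nonNeg (n · 1ℚ) {{ℚ.nonNegative (·-nonNeg n 0≤1)}} X≤ ⟩
  (L · (n · β)) ℚ.* (n · 1ℚ)    ≤⟨ *-mono-≤-nonNeg (·-nonNeg L (·-nonNeg n 0≤β)) (·-nonNeg n 0≤1)
                                     (ℚ.≤-trans (·-monoˡ-≤ (·-nonNeg n 0≤β) L≤M) (·-monoʳ-≤ M (·-monoˡ-≤ 0≤β n≤M)))
                                     (·-monoˡ-≤ 0≤1 n≤M) ⟩
  (M · (M · β)) ℚ.* (M · 1ℚ)    ≡⟨ cong (λ r → (M · (M · r)) ℚ.* (M · 1ℚ)) β≡h*[h*[h*1]] ⟩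
  (M · (M · (h ℚ.* (h ℚ.* (h ℚ.* 1ℚ))))) ℚ.* (M · 1ℚ)
                                ≡⟨ cong (λ r → (M · r) ℚ.* (M · 1ℚ)) (2^t·[½^t*r]≡r t _) ⟩
  (M · (h ℚ.* (h ℚ.* 1ℚ))) ℚ.* (M · 1ℚ)
                                ≡⟨ cong (ℚ._* (M · 1ℚ)) (2^t·[½^t*r]≡r t _) ⟩
  (h ℚ.* 1ℚ) ℚ.* (M · 1ℚ)       ≡⟨ ×-comm-* M (h ℚ.* 1ℚ) 1ℚ ⟩
  M · ((h ℚ.* 1ℚ) ℚ.* 1ℚ)       ≡⟨ cong (M ·_) (ℚ.*-identityʳ (h ℚ.* 1ℚ)) ⟩
  M · (h ℚ.* 1ℚ)                ≡⟨ 2^t·[½^t*r]≡r t 1ℚ ⟩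
  1ℚ                            ∎
  where
    open ℚ.≤-Reasoning
    M : ℕ
    M = 2 ^ t
    h β : ℚ
    h = ½ ^ℚ t
    β = ½ ^ℚ (3 * t)
    0≤β : 0ℚ ℚ.≤ β
    0≤β = 0≤½^n (3 * t)
    β≡h*[h*[h*1]] : β ≡ h ℚ.* (h ℚ.* (h ℚ.* 1ℚ))
    β≡h*[h*[h*1]] = trans (cong (½ ^ℚ_) (ℕ.*-comm 3 t)) (sym (^ℚ-assocʳ ½ t 3))

lemma6 : Σ ℕ λ C → Σ ℕ λ e → Σ ℕ λ a → Σ ℕ λ b → (1 ≤ a) × (1 ≤ b) ×
  ((n : ℕ) (G : Graph n) (s t : Fin n) (P : List (Fin n)) →
    IsShortestPath G s t P →
    ((Pr n (levels n ∸ 1)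
        (λ ω → not (goodAll G P (λ i → C * (1 + ⌊log₂ n ⌋) ^ e * 2 ^ (2 ^ i)) (levels n) ω)))
      ^ℚ b) ℚ.* ((+ n ℚ./ 1) ^ℚ a) ℚ.≤ 1ℚ)
-- Only the sampling matters: the bound holds for every vertex sequence P, shortest path or not.
lemma6 = 3 , 1 , 1 , 1 , s≤s z≤n , s≤s z≤n , λ n G _ _ P _ →
  let τ : ℕ
      τ = 1 + ⌊log₂ n ⌋
      X : ℚ
      X = Pr n (levels n ∸ 1) (λ ω → not (goodAll G P (λ i → 3 * τ ^ 1 * 2 ^ (2 ^ i)) (levels n) ω))
      n≤2^τ : n ≤ 2 ^ τ
      n≤2^τ = ℕ.<⇒≤ (n<2^[1+⌊log₂n⌋] n)
      X≤ : X ℚ.≤ levels n · (n · ½ ^ℚ (3 * τ))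
      X≤ = subst (λ e → X ℚ.≤ levels n · (n · ½ ^ℚ (3 * e))) (ℕ.^-identityʳ τ)
             (Pr-notGoodAll≤ G P (3 * τ ^ 1) (levels n))
  in begin
  (X ℚ.* 1ℚ) ℚ.* ((+ n ℚ./ 1) ℚ.* 1ℚ)  ≡⟨ cong₂ ℚ._*_ (ℚ.*-identityʳ X) (ℚ.*-identityʳ (+ n ℚ./ 1)) ⟩
  X ℚ.* (+ n ℚ./ 1)                    ≤⟨ L·[n·½^3t]·n≤1 τ (ℕ.≤-trans (levels≤n n) n≤2^τ) n≤2^τ X≤ ⟩
  1ℚ                                   ∎
  where open ℚ.≤-Reasoning
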